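{- If $A$ is a well-formed $\lambda\alpha$-term and $A\to B$ is a one-step reduction of $\lambda\alpha$, then $FV(A)\geqslant FV(B)$.
   Context: Variables $x,y,z,\ldots$; $\mathsf{x},\mathsf{y},\mathsf{z}$ range over variables. Terms and substitutions of $\lambda\alpha$: $A,B::=\mathsf{x}\mid AB\mid\lambda\mathsf{x}.A\mid S\circ A$, $S::=[B/\mathsf{x}]\mid W\mathsf{x}\mid\{\mathsf{y}\mathsf{x}\}\mid S_{\mathsf{x}}$; $S_1\circ S_2\circ A$ means $S_1\circ(S_2\circ A)$, $S\circ AB$ means $S\circ(AB)$, $\lambda\mathsf{x}.S\circ A$ means $\lambda\mathsf{x}.(S\circ A)$. A context $\Gamma$ is a pair $G,L$ of a finite set $G$ of variables and a finite list $L$ of variables with repetitions allowed; $\mathsf{x}\in\Gamma$ means $\mathsf{x}\in G$ or $\mathsf{x}$ occurs in $L$; $\Gamma,\mathsf{x}$ denotes $G,(L,\mathsf{x})$; a context with empty list is written $G$. Derivable judgements: $G\vdash\mathsf{x}$ if $\mathsf{x}\in G$; $\Gamma,\mathsf{x}\vdash\mathsf{x}$; from $\Gamma\vdash\mathsf{x}$ infer $\Gamma,\mathsf{y}\vdash\mathsf{x}$ ($\mathsf{x}\neq\mathsf{y}$); from $\Gamma\vdash A$, $\Gamma\vdash B$ infer $\Gamma\vdash AB$; from $\Gamma,\mathsf{x}\vdash A$ infer $\Gamma\vdash\lambda\mathsf{x}.A$; from $\Gamma\vdash S\triangleright\Delta$, $\Delta\vdash A$ infer $\Gamma\vdash S\circ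 A$; from $\Gamma\vdash B$ infer $\Gamma\vdash[B/\mathsf{x}]\triangleright\Gamma,\mathsf{x}$; $\Gamma,\mathsf{x}\vdash W\mathsf{x}\triangleright\Gamma$; $\Gamma,\mathsf{y}\vdash\{\mathsf{y}\mathsf{x}\}\triangleright\Gamma,\mathsf{x}$; from $\Gamma\vdash S\triangleright\Delta$ infer $\Gamma,\mathsf{x}\vdash S_{\mathsf{x}}\triangleright\Delta,\mathsf{x}$. $A$ is well-formed if $\Gamma\vdash A$ is derivable for some $\Gamma$. The order $\leqslant$ on contexts is the least partial order such that $G,L<G\cup\{\mathsf{x}\},L$ whenever $\mathsf{x}\notin G$, and $G,L<(G\setminus\{\mathsf{x}\}),L'$ where $L'$ is the list $\mathsf{x}$ followed by $L$. Free variables (partial): $FV(\mathsf{x})=\{\mathsf{x}\}$; $FV(AB)=FV(A)\sqcup FV(B)$; $FV(\lambda\mathsf{x}.A)=O_{\lambda\mathsf{x}}(FV(A))$; $FV(W\mathsf{x}\circ A)=FV(A),\mathsf{x}$; $FV([B/\mathsf{x}]\circ A)=FV((\lambda\mathsf{x}.A)B)$; $FV(\{\mathsf{y}\mathsf{x}\}\circ A)=FV(W\mathsf{y}\circ\lambda\mathsf{x}.A)$; $FV(S_{\mathsf{x}}\circ A)=FV(W\mathsf{x}\circ S\circ\lambda\mathsf{x}.A)$; where $O_{\lambda\mathsf{x}}(\Gamma,\mathsf{x})=\Gamma$, $O_{\lambda\mathsf{x}}(G)=G\setminus\{\mathsf{x}\}$, otherwise undefined; $(\Gamma,\mathsf{x})\sqcup(\Delta,\mathsf{x})=(\Gamma\sqcup\Delta),\mathsf{x}$,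 $(\Gamma,\mathsf{x})\sqcup G=(\Gamma\sqcup(G\setminus\{\mathsf{x}\})),\mathsf{x}$, $G\sqcup(\Gamma,\mathsf{x})=((G\setminus\{\mathsf{x}\})\sqcup\Gamma),\mathsf{x}$, $G_1\sqcup G_2=G_1\cup G_2$, otherwise undefined. One-step reduction of $\lambda\alpha$ is the closure under all constructors (under $\lambda\mathsf{x}.$, either side of application, either component of $S\circ A$, inside $B$ of $[B/\mathsf{x}]$, inside $S$ of $S_{\mathsf{x}}$) of: $(\lambda\mathsf{x}.A)B\to[B/\mathsf{x}]\circ A$; $S\circ AB\to(S\circ A)(S\circ B)$; $S\circ\lambda\mathsf{x}.A\to\lambda\mathsf{x}.S_{\mathsf{x}}\circ A$; $[B/\mathsf{x}]\circ\mathsf{x}\to B$; $[B/\mathsf{x}]\circ W\mathsf{x}\circ A\to A$; $[B/\mathsf{x}]\circ\mathsf{z}\to\mathsf{z}$ ($\mathsf{x}\neq\mathsf{z}$); $\{\mathsf{y}\mathsf{x}\}\circ\mathsf{x}\to\mathsf{y}$; $\{\mathsf{y}\mathsf{x}\}\circ W\mathsf{x}\circ A\to W\mathsf{y}\circ A$; $\{\mathsf{y}\mathsf{x}\}\circ\mathsf{z}\to W\mathsf{y}\circ\mathsf{z}$ ($\mathsf{x}\neq\mathsf{z}$); $S_{\mathsf{x}}\circ\mathsf{x}\to\mathsf{x}$; $S_{\mathsf{x}}\circ W\mathsf{x}\circ A\to W\mathsf{x}\circ S\circ A$; $S_{\mathsf{x}}\circ\mathsf{z}\to W\mathsf{x}\circ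 S\circ\mathsf{z}$ ($\mathsf{x}\neq\mathsf{z}$); $W\mathsf{x}\circ\mathsf{z}\to\mathsf{z}$ ($\mathsf{x}\neq\mathsf{z}$); $\lambda\mathsf{x}.A\to\lambda\mathsf{y}.\{\mathsf{y}\mathsf{x}\}\circ A$ provided $FV(\lambda\mathsf{x}.A)$ is defined, $\mathsf{x}\in FV(\lambda\mathsf{x}.A)$ and $\mathsf{y}\notin FV(\lambda\mathsf{x}.A)$. -}

module Defs where

open import Data.Nat using (ℕ; _≟_)
open import Data.List using (List; []; _∷_; _++_; filter)
open import Data.List.Membership.Propositional using (_∈_)
open import Data.Maybe using (Maybe; just; nothing; _>>=_; map)
open import Data.Product using (_×_; _,_; Σ)
open import Data.Sum using (_⊎_)
open import Relation.Nullary using (¬_; yes; no; ¬?)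
open import Relation.Binary.PropositionalEquality using (_≡_; _≢_)
open import Relation.Binary.Construct.Closure.ReflexiveTransitive using (Star)

Var : Set
Var = ℕ

infixr 5 _∘_
infixl 7 _·_

mutual
  data Term : Set where
    var : Var → Term
    _·_ : Term → Term → Term
    lam : Var → Term → Term
    _∘_ : Subst → Term → Term

  data Subst : Set where
    [_/_] : Term → Var → Subst
    W     : Var → Subst
    ⟨_,_⟩ : Var → Var → Subst        -- {y x} written ⟨ y , x ⟩
    lift  : Subst → Var → Subst      -- S_x written lift S x

-- Contexts: a finite set G (represented by a list, considered up to
-- having the same members) and a finite list L (a snoc-list; Γ , x
-- extends on the right).

infixl 5 _▸_
data Loc : Set where
  ε   : Loc
  _▸_ : Loc → Var → Loc

-- "x followed by L": x put at the leftmost (oldest) position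
_◂_ : Var → Loc → Loc
x ◂ ε       = ε ▸ x
x ◂ (L ▸ y) = (x ◂ L) ▸ y

record Ctx : Set where
  constructor ctx
  field
    glob : List Var
    loc  : Loc
open Ctx public

infixl 5 _,,_
_,,_ : Ctx → Var → Ctx
ctx G L ,, x = ctx G (L ▸ x)

gctx : List Var → Ctx
gctx G = ctx G ε

data _∈L_ (x : Var) : Loc → Set where
  here  : ∀ {L} → x ∈L (L ▸ x)
  there : ∀ {L y} → x ∈L L → x ∈L (L ▸ y)

_∈C_ : Var → Ctx → Set
x ∈C ctx G L = x ∈ G ⊎ x ∈L L

remove : Var → List Var → List Var
remove x G = filter (λ y → ¬? (y ≟ x)) G

infix 4 _⊢v_ _⊢_ _⊢s_▷_

data _⊢v_ : Ctx → Var → Set where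
  v-glob  : ∀ {G x} → x ∈ G → gctx G ⊢v x
  v-here  : ∀ {Γ x} → Γ ,, x ⊢v x
  v-there : ∀ {Γ x y} → Γ ⊢v x → x ≢ y → Γ ,, y ⊢v x

mutual
  data _⊢_ : Ctx → Term → Set where
    t-var : ∀ {Γ x} → Γ ⊢v x → Γ ⊢ var x
    t-app : ∀ {Γ A B} → Γ ⊢ A → Γ ⊢ B → Γ ⊢ A · B
    t-lam : ∀ {Γ x A} → Γ ,, x ⊢ A → Γ ⊢ lam x A
    t-sub : ∀ {Γ Δ S A} → Γ ⊢s S ▷ Δ → Δ ⊢ A → Γ ⊢ S ∘ A

  data _⊢s_▷_ : Ctx → Subst → Ctx → Set where
    s-sub  : ∀ {Γ B x} → Γ ⊢ B → Γ ⊢s [ B / x ] ▷ Γ ,, x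
    s-W    : ∀ {Γ x} → Γ ,, x ⊢s W x ▷ Γ
    s-swap : ∀ {Γ x y} → Γ ,, y ⊢s ⟨ y , x ⟩ ▷ Γ ,, x
    s-lift : ∀ {Γ Δ S x} → Γ ⊢s S ▷ Δ → Γ ,, x ⊢s lift S x ▷ Δ ,, x

WellFormed : Term → Set
WellFormed A = Σ Ctx λ Γ → Γ ⊢ A

_≈G_ : List Var → List Var → Set
G ≈G G' = ∀ x → (x ∈ G → x ∈ G') × (x ∈ G' → x ∈ G)

data CtxEq : Ctx → Ctx → Set where
  ceq : ∀ {G G' L} → G ≈G G' → CtxEq (ctx G L) (ctx G' L)

data CtxStep : Ctx → Ctx → Set where
  add  : ∀ {G L x} → ¬ (x ∈ G) → CtxStep (ctx G L) (ctx (x ∷ G) L)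
  move : ∀ {G L x} → CtxStep (ctx G L) (ctx (remove x G) (x ◂ L))

data CtxGen (Γ Δ : Ctx) : Set where
  step : CtxStep Γ Δ → CtxGen Γ Δ
  same : CtxEq Γ Δ → CtxGen Γ Δ

infix 4 _≤C_
_≤C_ : Ctx → Ctx → Set
_≤C_ = Star CtxGen

O : Var → Ctx → Maybe Ctx
O x (ctx G ε) = just (ctx (remove x G) ε)
O x (ctx G (L ▸ y)) with x ≟ y
... | yes _ = just (ctx G L)
... | no  _ = nothing

join : List Var → Loc → List Var → Loc → Maybe Ctx
join G₁ (L₁ ▸ x) G₂ (L₂ ▸ y) with x ≟ y
... | yes _ = map (_,, x) (join G₁ L₁ G₂ L₂)
... | no  _ = nothing
join G₁ (L₁ ▸ x) G₂ ε = map (_,, x) (join G₁ L₁ (remove x G₂) ε)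
join G₁ ε G₂ (L₂ ▸ x) = map (_,, x) (join (remove x G₁) ε G₂ L₂)
join G₁ ε G₂ ε = just (ctx (G₁ ++ G₂) ε)

_⊔_ : Maybe Ctx → Maybe Ctx → Maybe Ctx
m₁ ⊔ m₂ = m₁ >>= λ Γ → m₂ >>= λ Δ → join (glob Γ) (loc Γ) (glob Δ) (loc Δ)

O? : Var → Maybe Ctx → Maybe Ctx
O? x m = m >>= O x

ext? : Maybe Ctx → Var → Maybe Ctx
ext? m x = map (_,, x) m

mutual
  FV : Term → Maybe Ctx
  FV (var x)   = just (ctx (x ∷ []) ε)
  FV (A · B)   = FV A ⊔ FV B
  FV (lam x A) = O? x (FV A)
  FV (S ∘ A)   = FVs S (FV A)

  -- FVs S (FV A) = FV (S ∘ A); the defining clauses unfolded: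
  --  FV([B/x]∘A) = FV((λx.A)B), FV(W x∘A) = FV(A),x,
  --  FV({y x}∘A) = FV(W y∘λx.A), FV(S_x∘A) = FV(W x∘S∘λx.A)
  FVs : Subst → Maybe Ctx → Maybe Ctx
  FVs [ B / x ]  m = O? x m ⊔ FV B
  FVs (W x)      m = ext? m x
  FVs ⟨ y , x ⟩  m = ext? (O? x m) y
  FVs (lift S x) m = ext? (FVs S (O? x m)) x

infix 4 _⟶_ _⟶s_

mutual
  data _⟶_ : Term → Term → Set where
    β        : ∀ {x A B} → lam x A · B ⟶ [ B / x ] ∘ A
    σ-app    : ∀ {S A B} → S ∘ (A · B) ⟶ (S ∘ A) · (S ∘ B)
    σ-lam    : ∀ {S x A} → S ∘ lam x A ⟶ lam x (lift S x ∘ A)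
    sub-var  : ∀ {B x} → [ B / x ] ∘ var x ⟶ B
    sub-W    : ∀ {B x A} → [ B / x ] ∘ W x ∘ A ⟶ A
    sub-oth  : ∀ {B x z} → x ≢ z → [ B / x ] ∘ var z ⟶ var z
    swp-var  : ∀ {y x} → ⟨ y , x ⟩ ∘ var x ⟶ var y
    swp-W    : ∀ {y x A} → ⟨ y , x ⟩ ∘ W x ∘ A ⟶ W y ∘ A
    swp-oth  : ∀ {y x z} → x ≢ z → ⟨ y , x ⟩ ∘ var z ⟶ W y ∘ var z
    lift-var : ∀ {S x} → lift S x ∘ var x ⟶ var x
    lift-W   : ∀ {S x A} → lift S x ∘ W x ∘ A ⟶ W x ∘ S ∘ A
    lift-oth : ∀ {S x z} → x ≢ z → lift S x ∘ var z ⟶ W x ∘ S ∘ var z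
    W-oth    : ∀ {x z} → x ≢ z → W x ∘ var z ⟶ var z
    α        : ∀ {x y A Γ} → FV (lam x A) ≡ just Γ → x ∈C Γ → ¬ (y ∈C Γ)
             → lam x A ⟶ lam y (⟨ y , x ⟩ ∘ A)
    c-lam    : ∀ {x A A'} → A ⟶ A' → lam x A ⟶ lam x A'
    c-appˡ   : ∀ {A A' B} → A ⟶ A' → A · B ⟶ A' · B
    c-appʳ   : ∀ {A B B'} → B ⟶ B' → A · B ⟶ A · B'
    c-subˡ   : ∀ {S S' A} → S ⟶s S' → S ∘ A ⟶ S' ∘ A
    c-subʳ   : ∀ {S A A'} → A ⟶ A' → S ∘ A ⟶ S ∘ A'

  data _⟶s_ : Subst → Subst → Set where
    c-[]   : ∀ {B B' x} → B ⟶ B' → [ B / x ] ⟶s [ B' / x ]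
    c-lift : ∀ {S S' x} → S ⟶s S' → lift S x ⟶s lift S' x

module Submission where

-- The order ≤C is generated by syntactic moves on representations of
-- contexts, which is awkward to reason with.  We replace it by a direct
-- "semantic" order Δ ≼ Γ: the list of Γ is the list of Δ with a prefix P
-- added on the old end, and every global variable of Δ is global in Γ or
-- occurs in P.  We show
--   * ≼ is a preorder and `join` computes least upper bounds for it;
--   * lifting ≼ to partial contexts (m' ⊑ m: if m is defined, so is m',
--     and below it), the operations ⊔, O?, ext? and FVs S are monotone;
--   * every reduction step A ⟶ B gives FV B ⊑ FV A (by induction on the
--     step, with monotonicity handling the congruence rules);
--   * Γ ⊢ A gives FV A ⊑ just Γ, so FV of a well-formed term is defined;
--   * Δ ≼ Γ implies Δ ≤C Γ (add missing globals, then move P into the list).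

open import Defs
open import Data.List using (List; []; _∷_; _++_)
open import Data.List.Membership.Propositional using (_∈_)
open import Data.List.Membership.Propositional.Properties using (∈-filter⁺; ∈-filter⁻; ∈-++⁺ˡ; ∈-++⁺ʳ; ∈-++⁻)
open import Data.List.Relation.Unary.Any using (here; there)
open import Data.Maybe using (Maybe; just; nothing)
open import Data.Nat using (_≟_)
open import Data.List.Membership.DecPropositional _≟_ using (_∈?_)
open import Data.Product using (Σ; _×_; _,_; proj₁; proj₂)
open import Data.Sum using (_⊎_; inj₁; inj₂)
open import Data.Empty using (⊥-elim)
open import Relation.Nullary using (¬_; yes; no; ¬?)
open import Relation.Binary.PropositionalEquality using (_≡_; _≢_; refl; sym; trans; subst; cong)
open import Relation.Binary.Construct.Closure.ReflexiveTransitive using (ε; _◅_; _◅◅_)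

-- Concatenation of local lists: P ++L L puts the (older) list P before L.
infixr 5 _++L_
_++L_ : Loc → Loc → Loc
ε       ++L L = L
(P ▸ x) ++L L = P ++L (x ◂ L)

++L-▸ : ∀ P L y → P ++L (L ▸ y) ≡ (P ++L L) ▸ y
++L-▸ ε       L y = refl
++L-▸ (P ▸ x) L y = ++L-▸ P (x ◂ L) y

++L-identityʳ : ∀ P → P ++L ε ≡ P
++L-identityʳ ε       = refl
++L-identityʳ (P ▸ x) = trans (++L-▸ P ε x) (cong (_▸ x) (++L-identityʳ P))

◂-++L : ∀ x P L → (x ◂ P) ++L L ≡ x ◂ (P ++L L)
◂-++L x ε       L = refl
◂-++L x (P ▸ y) L = ◂-++L x P (y ◂ L)

++L-assoc : ∀ Q P L → (Q ++L P) ++L L ≡ Q ++L (P ++L L)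
++L-assoc ε       P L = refl
++L-assoc (Q ▸ x) P L = trans (++L-assoc Q (x ◂ P) L) (cong (Q ++L_) (◂-++L x P L))

++L-ε-inv : ∀ P L → P ++L L ≡ ε → L ≡ ε
++L-ε-inv P ε       _ = refl
++L-ε-inv P (L ▸ z) e with trans (sym (++L-▸ P L z)) e
... | ()

▸-injective : ∀ {L L' x y} → L ▸ x ≡ L' ▸ y → L ≡ L' × x ≡ y
▸-injective refl = refl , refl

∈L-◂⁺ʳ : ∀ {v} x L → v ∈L L → v ∈L (x ◂ L)
∈L-◂⁺ʳ x (L ▸ y) here      = here
∈L-◂⁺ʳ x (L ▸ y) (there p) = there (∈L-◂⁺ʳ x L p)

∈L-◂⁺ˡ : ∀ x L → x ∈L (x ◂ L)
∈L-◂⁺ˡ x ε       = here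
∈L-◂⁺ˡ x (L ▸ y) = there (∈L-◂⁺ˡ x L)

∈L-++⁺ʳ : ∀ {v} P L → v ∈L L → v ∈L (P ++L L)
∈L-++⁺ʳ ε       L p = p
∈L-++⁺ʳ (P ▸ x) L p = ∈L-++⁺ʳ P (x ◂ L) (∈L-◂⁺ʳ x L p)

∈L-++⁺ˡ : ∀ {v} P L → v ∈L P → v ∈L (P ++L L)
∈L-++⁺ˡ (P ▸ x) L here      = ∈L-++⁺ʳ P (x ◂ L) (∈L-◂⁺ˡ x L)
∈L-++⁺ˡ (P ▸ x) L (there p) = ∈L-++⁺ˡ P (x ◂ L) p

∈-remove⁺ : ∀ {v x G} → v ∈ G → v ≢ x → v ∈ remove x G
∈-remove⁺ {x = x} = ∈-filter⁺ (λ y → ¬? (y ≟ x))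

∈-remove⁻ : ∀ {v x G} → v ∈ remove x G → v ∈ G × v ≢ x
∈-remove⁻ {x = x} = ∈-filter⁻ (λ y → ¬? (y ≟ x))

infix 4 _≼_
record _≼_ (Δ Γ : Ctx) : Set where
  constructor below
  field
    prefix : Loc
    loc-≡  : loc Γ ≡ prefix ++L loc Δ
    glob-↑ : ∀ v → v ∈ glob Δ → v ∈ glob Γ ⊎ v ∈L prefix
open _≼_

≼-refl : ∀ Γ → Γ ≼ Γ
≼-refl Γ = below ε refl (λ _ → inj₁)

≼-trans : ∀ {Δ Γ Θ} → Δ ≼ Γ → Γ ≼ Θ → Δ ≼ Θ
≼-trans {Δ} {Γ} {Θ} (below P e s) (below Q e' s') =
  below (Q ++L P) (trans e' (trans (cong (Q ++L_) e) (sym (++L-assoc Q P (loc Δ))))) cover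
  where
  cover : ∀ v → v ∈ glob Δ → v ∈ glob Θ ⊎ v ∈L (Q ++L P)
  cover v p with s v p
  ... | inj₂ q = inj₂ (∈L-++⁺ʳ Q P q)
  ... | inj₁ q with s' v q
  ...   | inj₁ r = inj₁ r
  ...   | inj₂ r = inj₂ (∈L-++⁺ˡ Q P r)

≼-,, : ∀ {G L H M y} → ctx G L ≼ ctx H M → ctx G (L ▸ y) ≼ ctx H (M ▸ y)
≼-,, {L = L} {y = y} (below P e s) = below P (trans (cong (_▸ y) e) (sym (++L-▸ P L y))) s

≼-peel : ∀ {G L x H M} → ctx G (L ▸ x) ≼ ctx H M
       → Σ Loc λ M' → M ≡ M' ▸ x × ctx G L ≼ ctx H M'
≼-peel {L = L} {x} (below P e s) = P ++L L , trans e (++L-▸ P L x) , below P refl s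

≼-glob-⊆ : ∀ {G H M} → ctx G ε ≼ ctx H M → ∀ v → v ∈ G → v ∈ H ⊎ v ∈L M
≼-glob-⊆ (below P e s) v p with s v p
... | inj₁ q = inj₁ q
... | inj₂ q = inj₂ (subst (v ∈L_) (sym (trans e (++L-identityʳ P))) q)

-- For a global context G: G ≼ (H , M ▸ x) iff G ∖ {x} ≼ (H , M).
-- These describe how `join` and O treat a global operand.
≼-unbind : ∀ {G H M x} → ctx G ε ≼ ctx H (M ▸ x) → ctx (remove x G) ε ≼ ctx H M
≼-unbind {G} {H} {M} {x} r = below M (sym (++L-identityʳ M)) cover
  where
  cover : ∀ v → v ∈ remove x G → v ∈ H ⊎ v ∈L M
  cover v p with ∈-remove⁻ p
  ... | q , v≢x with ≼-glob-⊆ r v q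
  ...   | inj₁ h         = inj₁ h
  ...   | inj₂ here      = ⊥-elim (v≢x refl)
  ...   | inj₂ (there h) = inj₂ h

≼-bind : ∀ {G H M x} → ctx (remove x G) ε ≼ ctx H M → ctx G ε ≼ ctx H (M ▸ x)
≼-bind {G} {H} {M} {x} r = below (M ▸ x) (sym (++L-identityʳ (M ▸ x))) cover
  where
  cover : ∀ v → v ∈ G → v ∈ H ⊎ v ∈L (M ▸ x)
  cover v p with v ≟ x
  ... | yes refl = inj₂ here
  ... | no v≢x with ≼-glob-⊆ r v (∈-remove⁺ p v≢x)
  ...   | inj₁ h = inj₁ h
  ...   | inj₂ h = inj₂ (there h)

join-upper : ∀ G₁ L₁ G₂ L₂ J → join G₁ L₁ G₂ L₂ ≡ just J
           → ctx G₁ L₁ ≼ J × ctx G₂ L₂ ≼ J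
join-upper G₁ (L₁ ▸ x) G₂ (L₂ ▸ y) J eq with x ≟ y
join-upper G₁ (L₁ ▸ x) G₂ (L₂ ▸ y) J () | no _
... | yes refl with join G₁ L₁ G₂ L₂ in e
... | just _ with eq
... | refl with join-upper G₁ L₁ G₂ L₂ _ e
... | r₁ , r₂ = ≼-,, r₁ , ≼-,, r₂
join-upper G₁ (L₁ ▸ x) G₂ ε J eq with join G₁ L₁ (remove x G₂) ε in e
... | just _ with eq
... | refl with join-upper G₁ L₁ (remove x G₂) ε _ e
... | r₁ , r₂ = ≼-,, r₁ , ≼-bind r₂
join-upper G₁ ε G₂ (L₂ ▸ x) J eq with join (remove x G₁) ε G₂ L₂ in e
... | just _ with eq
... | refl with join-upper (remove x G₁) ε G₂ L₂ _ e
... | r₁ , r₂ = ≼-bind r₁ , ≼-,, r₂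
join-upper G₁ ε G₂ ε J refl =
  below ε refl (λ _ p → inj₁ (∈-++⁺ˡ p)) , below ε refl (λ _ p → inj₁ (∈-++⁺ʳ G₁ p))

join-least : ∀ G₁ L₁ G₂ L₂ H M → ctx G₁ L₁ ≼ ctx H M → ctx G₂ L₂ ≼ ctx H M
           → Σ Ctx λ J → join G₁ L₁ G₂ L₂ ≡ just J × J ≼ ctx H M
join-least G₁ (L₁ ▸ x) G₂ (L₂ ▸ y) H M r₁ r₂ with ≼-peel r₁ | ≼-peel r₂
... | M₁ , e₁ , q₁ | M₂ , e₂ , q₂ with ▸-injective (trans (sym e₁) e₂)
... | refl , refl with x ≟ x
... | no x≢x = ⊥-elim (x≢x refl)
... | yes refl with join-least G₁ L₁ G₂ L₂ H M₁ q₁ q₂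
... | ctx J K , e , q rewrite e | e₁ = ctx J (K ▸ x) , refl , ≼-,, q
join-least G₁ (L₁ ▸ x) G₂ ε H M r₁ r₂ with ≼-peel r₁
... | M₁ , e₁ , q₁ rewrite e₁ with join-least G₁ L₁ (remove x G₂) ε H M₁ q₁ (≼-unbind r₂)
... | ctx J K , e , q rewrite e = ctx J (K ▸ x) , refl , ≼-,, q
join-least G₁ ε G₂ (L₂ ▸ x) H M r₁ r₂ with ≼-peel r₂
... | M₂ , e₂ , q₂ rewrite e₂ with join-least (remove x G₁) ε G₂ L₂ H M₂ (≼-unbind r₁) q₂
... | ctx J K , e , q rewrite e = ctx J (K ▸ x) , refl , ≼-,, q
join-least G₁ ε G₂ ε H M r₁ r₂ = ctx (G₁ ++ G₂) ε , refl , below M (sym (++L-identityʳ M)) cover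
  where
  cover : ∀ v → v ∈ G₁ ++ G₂ → v ∈ H ⊎ v ∈L M
  cover v p with ∈-++⁻ G₁ p
  ... | inj₁ q = ≼-glob-⊆ r₁ v q
  ... | inj₂ q = ≼-glob-⊆ r₂ v q

O-≼ : ∀ x G L H M Γ → ctx G L ≼ ctx H M → O x (ctx H M) ≡ just Γ
    → Σ Ctx λ Γ' → O x (ctx G L) ≡ just Γ' × Γ' ≼ Γ
O-≼ x G L H ε Γ r e with ++L-ε-inv (prefix r) L (sym (loc-≡ r))
O-≼ x G .ε H ε Γ r refl | refl = _ , refl , below ε refl cover
  where
  cover : ∀ v → v ∈ remove x G → v ∈ remove x H ⊎ v ∈L ε
  cover v p with ∈-remove⁻ p
  ... | q , v≢x with ≼-glob-⊆ r v q
  ...   | inj₁ h = inj₁ (∈-remove⁺ h v≢x)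
  ...   | inj₂ ()
O-≼ x G L H (M ▸ y) Γ r e with x ≟ y
O-≼ x G L H (M ▸ y) Γ r () | no _
O-≼ x G ε H (M ▸ .x) .(ctx H M) r refl | yes refl = _ , refl , ≼-unbind r
O-≼ x G (L ▸ z) H (M ▸ .x) .(ctx H M) r refl | yes refl with ≼-peel r
... | M' , e' , q with ▸-injective e'
... | refl , refl with x ≟ x
... | yes _  = _ , refl , q
... | no x≢x = ⊥-elim (x≢x refl)

infix 4 _⊑_
_⊑_ : Maybe Ctx → Maybe Ctx → Set
m' ⊑ m = ∀ Γ → m ≡ just Γ → Σ Ctx λ Δ → m' ≡ just Δ × Δ ≼ Γ

⊑-refl : ∀ m → m ⊑ m
⊑-refl m Γ e = Γ , e , ≼-refl Γ

⊑-trans : ∀ {a b c} → a ⊑ b → b ⊑ c → a ⊑ c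
⊑-trans a⊑b b⊑c Γ e with b⊑c Γ e
... | Δ , e' , r with a⊑b Δ e'
... | Θ , e'' , r' = Θ , e'' , ≼-trans r' r

⊑-reflexive : ∀ {a b} → a ≡ b → a ⊑ b
⊑-reflexive refl = ⊑-refl _

just-⊑ : ∀ {Δ Γ} → Δ ≼ Γ → just Δ ⊑ just Γ
just-⊑ r Γ refl = _ , refl , r

⊔-upper : ∀ m₁ m₂ → (m₁ ⊑ m₁ ⊔ m₂) × (m₂ ⊑ m₁ ⊔ m₂)
⊔-upper nothing            m₂                 = (λ _ ()) , (λ _ ())
⊔-upper (just _)           nothing            = (λ _ ()) , (λ _ ())
⊔-upper (just (ctx G₁ L₁)) (just (ctx G₂ L₂)) =
  (λ J e → _ , refl , proj₁ (join-upper G₁ L₁ G₂ L₂ J e)) ,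
  (λ J e → _ , refl , proj₂ (join-upper G₁ L₁ G₂ L₂ J e))

⊔-least : ∀ {m₁ m₂ m} → m₁ ⊑ m → m₂ ⊑ m → m₁ ⊔ m₂ ⊑ m
⊔-least m₁⊑m m₂⊑m (ctx H M) e with m₁⊑m _ e | m₂⊑m _ e
... | ctx G₁ L₁ , refl , r₁ | ctx G₂ L₂ , refl , r₂ = join-least G₁ L₁ G₂ L₂ H M r₁ r₂

⊔-mono : ∀ {a a' b b'} → a' ⊑ a → b' ⊑ b → a' ⊔ b' ⊑ a ⊔ b
⊔-mono {a} {b = b} p q = ⊔-least (⊑-trans p (proj₁ (⊔-upper a b))) (⊑-trans q (proj₂ (⊔-upper a b)))

ext-mono : ∀ {m m'} x → m' ⊑ m → ext? m' x ⊑ ext? m x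
ext-mono {nothing}         x p Γ ()
ext-mono {just (ctx H M)} x p Γ refl with p _ refl
... | ctx G L , refl , r = _ , refl , ≼-,, r

O-mono : ∀ {m m'} x → m' ⊑ m → O? x m' ⊑ O? x m
O-mono {nothing}         x p Γ ()
O-mono {just (ctx H M)} x p Γ e with p _ refl
... | ctx G L , refl , r = O-≼ x G L H M Γ r e

FVs-mono : ∀ S {m m'} → m' ⊑ m → FVs S m' ⊑ FVs S m
FVs-mono [ B / x ]  p = ⊔-mono (O-mono x p) (⊑-refl (FV B))
FVs-mono (W x)      p = ext-mono x p
FVs-mono ⟨ y , x ⟩  p = ext-mono y (O-mono x p)
FVs-mono (lift S x) p = ext-mono x (FVs-mono S (O-mono x p))

O-ext : ∀ x m → O? x (ext? m x) ≡ m
O-ext x nothing          = refl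
O-ext x (just (ctx G L)) with x ≟ x
... | yes _  = refl
... | no x≢x = ⊥-elim (x≢x refl)

var-⊑-O : ∀ x z → x ≢ z → FV (var z) ⊑ O? x (FV (var z))
var-⊑-O x z x≢z = just-⊑ (below ε refl cover)
  where
  cover : ∀ v → v ∈ z ∷ [] → v ∈ remove x (z ∷ []) ⊎ v ∈L ε
  cover v (here refl) = inj₁ (∈-remove⁺ (here refl) (λ e → x≢z (sym e)))

-- The rule S_x ∘ x ⟶ x: when FV(S_x ∘ x) is defined its list ends in x,
-- so it lies above FV(x) = {x}.
lift-var-⊑ : ∀ S x → FV (var x) ⊑ FVs (lift S x) (FV (var x))
lift-var-⊑ S x Γ e with FVs S (O? x (FV (var x)))
lift-var-⊑ S x .(ctx G (L ▸ x)) refl | just (ctx G L) =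
  _ , refl , below (L ▸ x) (sym (++L-identityʳ (L ▸ x))) (λ { v (here refl) → inj₂ here })

mutual
  FV-⟶ : ∀ {A B} → A ⟶ B → FV B ⊑ FV A
  FV-⟶ β = ⊑-refl _
  FV-⟶ {S ∘ (A · B)} σ-app =
    ⊔-least (FVs-mono S (proj₁ (⊔-upper (FV A) (FV B)))) (FVs-mono S (proj₂ (⊔-upper (FV A) (FV B))))
  FV-⟶ {S ∘ lam x A} σ-lam = ⊑-reflexive (O-ext x (FVs S (O? x (FV A))))
  FV-⟶ {[ B / x ] ∘ var .x} sub-var = proj₂ (⊔-upper (O? x (FV (var x))) (FV B))
  FV-⟶ {[ B / x ] ∘ (W .x ∘ A)} sub-W =
    subst (λ m → FV A ⊑ m ⊔ FV B) (sym (O-ext x (FV A))) (proj₁ (⊔-upper (FV A) (FV B)))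
  FV-⟶ {[ B / x ] ∘ var z} (sub-oth x≢z) =
    ⊑-trans (var-⊑-O x z x≢z) (proj₁ (⊔-upper (O? x (FV (var z))) (FV B)))
  FV-⟶ swp-var = just-⊑ (below (ε ▸ _) refl (λ { v (here refl) → inj₂ here }))
  FV-⟶ {⟨ y , x ⟩ ∘ (W .x ∘ A)} swp-W = ⊑-reflexive (cong (λ m → ext? m y) (sym (O-ext x (FV A))))
  FV-⟶ {⟨ y , x ⟩ ∘ var z} (swp-oth x≢z) = ext-mono y (var-⊑-O x z x≢z)
  FV-⟶ {lift S x ∘ var .x} lift-var = lift-var-⊑ S x
  FV-⟶ {lift S x ∘ (W .x ∘ A)} lift-W = ⊑-reflexive (cong (λ m → ext? (FVs S m) x) (sym (O-ext x (FV A))))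
  FV-⟶ {lift S x ∘ var z} (lift-oth x≢z) = ext-mono x (FVs-mono S (var-⊑-O x z x≢z))
  FV-⟶ (W-oth _) = just-⊑ (below (ε ▸ _) refl (λ _ → inj₁))
  FV-⟶ {lam x A} {lam y _} (α _ _ _) = ⊑-reflexive (O-ext y (O? x (FV A)))
  FV-⟶ (c-lam {x} r) = O-mono x (FV-⟶ r)
  FV-⟶ (c-appˡ {B = B} r) = ⊔-mono (FV-⟶ r) (⊑-refl (FV B))
  FV-⟶ (c-appʳ {A} r) = ⊔-mono (⊑-refl (FV A)) (FV-⟶ r)
  FV-⟶ (c-subˡ {A = A} r) = FVs-⟶s r (FV A)
  FV-⟶ (c-subʳ {S} r) = FVs-mono S (FV-⟶ r)

  FVs-⟶s : ∀ {S S'} → S ⟶s S' → ∀ m → FVs S' m ⊑ FVs S m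
  FVs-⟶s (c-[] {x = x} r)   m = ⊔-mono (⊑-refl (O? x m)) (FV-⟶ r)
  FVs-⟶s (c-lift {x = x} r) m = ext-mono x (FVs-⟶s r (O? x m))

⊢v-≼ : ∀ {Γ x} → Γ ⊢v x → ctx (x ∷ []) ε ≼ Γ
⊢v-≼ (v-glob p) = below ε refl (λ { v (here refl) → inj₁ p })
⊢v-≼ {ctx G (L ▸ x)} v-here =
  below (L ▸ x) (sym (++L-identityʳ _)) (λ { v (here refl) → inj₂ here })
⊢v-≼ {ctx G (L ▸ y)} (v-there d _) =
  below (L ▸ y) (sym (++L-identityʳ _)) (λ { v (here refl) → weaken (≼-glob-⊆ (⊢v-≼ d) v (here refl)) })
  where
  weaken : ∀ {v} → v ∈ G ⊎ v ∈L L → v ∈ G ⊎ v ∈L (L ▸ y)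
  weaken (inj₁ p) = inj₁ p
  weaken (inj₂ p) = inj₂ (there p)

mutual
  FV-⊢ : ∀ {Γ A} → Γ ⊢ A → FV A ⊑ just Γ
  FV-⊢ (t-var d) = just-⊑ (⊢v-≼ d)
  FV-⊢ (t-app d e) = ⊔-least (FV-⊢ d) (FV-⊢ e)
  FV-⊢ {Γ} {lam x A} (t-lam d) = subst (O? x (FV A) ⊑_) (O-ext x (just Γ)) (O-mono x (FV-⊢ d))
  FV-⊢ {A = S ∘ A} (t-sub s d) = ⊑-trans (FVs-mono S (FV-⊢ d)) (FVs-⊢s s)

  FVs-⊢s : ∀ {Γ S Δ} → Γ ⊢s S ▷ Δ → FVs S (just Δ) ⊑ just Γ
  FVs-⊢s {Γ} {[ B / x ]} (s-sub d) =
    subst (λ m → m ⊔ FV B ⊑ just Γ) (sym (O-ext x (just Γ))) (⊔-least (⊑-refl _) (FV-⊢ d))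
  FVs-⊢s s-W = ⊑-refl _
  FVs-⊢s {ctx G (L ▸ y)} {⟨ .y , x ⟩} s-swap = ⊑-reflexive (cong (λ m → ext? m y) (O-ext x (just (ctx G L))))
  FVs-⊢s {ctx G (L ▸ x)} {lift S .x} {ctx H (M ▸ .x)} (s-lift s) =
    ext-mono x (subst (λ m → FVs S m ⊑ just (ctx G L)) (sym (O-ext x (just (ctx H M)))) (FVs-⊢s s))

≤C-addAll : ∀ K G L → ctx G L ≤C ctx (K ++ G) L
≤C-addAll []      G L = ε
≤C-addAll (k ∷ K) G L with k ∈? (K ++ G)
... | no k∉ = ≤C-addAll K G L ◅◅ (step (add k∉) ◅ ε)
... | yes k∈ = ≤C-addAll K G L ◅◅ (same (ceq dup) ◅ ε)
  where
  dup : (K ++ G) ≈G (k ∷ K ++ G)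
  dup v = there , λ { (here refl) → k∈ ; (there p) → p }

removeAll : Loc → List Var → List Var
removeAll ε       H = H
removeAll (P ▸ x) H = removeAll P (remove x H)

∈-removeAll⁻ : ∀ {v} P H → v ∈ removeAll P H → v ∈ H × ¬ v ∈L P
∈-removeAll⁻ ε       H p = p , λ ()
∈-removeAll⁻ (P ▸ x) H p with ∈-removeAll⁻ P (remove x H) p
... | q , v∉P with ∈-remove⁻ q
... | q' , v≢x = q' , λ { here → v≢x refl ; (there h) → v∉P h }

≤C-moveAll : ∀ P H L → ctx H L ≤C ctx (removeAll P H) (P ++L L)
≤C-moveAll ε       H L = ε
≤C-moveAll (P ▸ x) H L = step move ◅ ≤C-moveAll P (remove x H) (x ◂ L)

-- From (G , L),
-- add the globals G' of Γ, move P into the list, and observe that the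
-- resulting global set coincides with G' up to set equality.
≼⇒≤C : ∀ {Δ Γ} → Δ ≼ Γ → Δ ≤C Γ
≼⇒≤C {ctx G L} {ctx G' M} (below P refl s) =
  ≤C-addAll G' G L ◅◅ ≤C-moveAll P (G' ++ G) L ◅◅ ≤C-addAll G' G'' (P ++L L) ◅◅ (same (ceq sameSet) ◅ ε)
  where
  G'' : List Var
  G'' = removeAll P (G' ++ G)

  shrink : ∀ {v} → v ∈ G' ++ G'' → v ∈ G'
  shrink {v} p with ∈-++⁻ G' p
  ... | inj₁ q = q
  ... | inj₂ q with ∈-removeAll⁻ P (G' ++ G) q
  ...   | q' , v∉P with ∈-++⁻ G' q'
  ...     | inj₁ r = r
  ...     | inj₂ r with s v r
  ...       | inj₁ t = t
  ...       | inj₂ t = ⊥-elim (v∉P t)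

  sameSet : (G' ++ G'') ≈G G'
  sameSet v = shrink , ∈-++⁺ˡ

mainTheorem6 : ∀ (A B : Term) → WellFormed A → A ⟶ B
             → Σ Ctx λ Γ → Σ Ctx λ Δ → FV A ≡ just Γ × FV B ≡ just Δ × Δ ≤C Γ
mainTheorem6 A B (Θ , ⊢A) A⟶B with FV-⊢ ⊢A Θ refl
... | Γ , FVA≡Γ , _ with FV-⟶ A⟶B Γ FVA≡Γ
... | Δ , FVB≡Δ , Δ≼Γ = Γ , Δ , FVA≡Γ , FVB≡Δ , ≼⇒≤C Δ≼Γ
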